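{- For every $n\ge 1$, the map $s_{\{123,132\}}:S_n\to S_n$ has exactly $\lfloor\frac{n}{2}\rfloor!$ periodic orbits.
   Context: A point $a$ is periodic for $f:A\to A$ if $f^k(a)=a$ for some integer $k>0$; a periodic orbit is the orbit of a periodic point. A sequence of distinct integers contains a permutation $\tau$ if some subsequence is order-isomorphic to $\tau$; otherwise it avoids $\tau$. For a set $T$ of permutations, the map $s_T$ is defined by: read the input permutation left to right with an initially empty stack and output; at each step, if there is a next input element and pushing it keeps the stack contents, read from top to bottom, $T$-avoiding, push it; otherwise pop the top of the stack and append it to the output; stop when input and stack are empty; the output is $s_T(\pi)$. -}

module Defs where

open import Data.Nat using (ℕ; zero; suc; _<_; _<ᵇ_; _≤_)
open import Data.Bool using (Bool; true; false; _∧_; not; if_then_else_)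
open import Data.List using (List; []; _∷_; _++_; map; length; applyUpTo)
open import Data.Bool.ListAction using (any; all)
open import Data.List.Relation.Binary.Permutation.Propositional using (_↭_)
open import Data.Fin using (Fin)
open import Data.Product using (Σ; _×_; ∃)
open import Relation.Binary.PropositionalEquality using (_≡_)

orderIsoᵇ : List ℕ → List ℕ → Bool
orderIsoᵇ [] [] = true
orderIsoᵇ [] (_ ∷ _) = false
orderIsoᵇ (_ ∷ _) [] = false
orderIsoᵇ (x ∷ xs) (y ∷ ys) = pairs xs ys ∧ orderIsoᵇ xs ys
  where
  pairs : List ℕ → List ℕ → Bool
  pairs [] [] = true
  pairs [] (_ ∷ _) = false
  pairs (_ ∷ _) [] = false
  pairs (a ∷ as) (b ∷ bs) =
    (if x <ᵇ a then (y <ᵇ b) else not (y <ᵇ b)) ∧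
    (if a <ᵇ x then (b <ᵇ y) else not (b <ᵇ y)) ∧ pairs as bs

subseqs : List ℕ → List (List ℕ)
subseqs [] = [] ∷ []
subseqs (x ∷ xs) = map (x ∷_) (subseqs xs) ++ subseqs xs

containsᵇ : List ℕ → List ℕ → Bool
containsᵇ σ τ = any (λ s → orderIsoᵇ s τ) (subseqs σ)

avoidsᵇ : List (List ℕ) → List ℕ → Bool
avoidsᵇ T σ = all (λ τ → not (containsᵇ σ τ)) T

-- Stack (top of the stack = head of the list).
-- pushPop T x st : pop elements from the top of st until x can be pushed
-- keeping the stack (read top to bottom) T-avoiding; returns the popped
-- elements (in output order) and the new stack with x on top.
-- (The case "stack empty and x cannot be pushed" never arises when all
-- patterns of T have length ≥ 2; there we simply push.)
pushPop : List (List ℕ) → ℕ → List ℕ → List ℕ × List ℕ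
pushPop T x st with avoidsᵇ T (x ∷ st)
... | true = [] Data.Product., (x ∷ st)
pushPop T x [] | false = [] Data.Product., (x ∷ [])
pushPop T x (y ∷ ys) | false with pushPop T x ys
... | p Data.Product., s = (y ∷ p) Data.Product., s

run : List (List ℕ) → List ℕ → List ℕ → List ℕ
run T [] st = st
run T (x ∷ xs) st with pushPop T x st
... | p Data.Product., s = p ++ run T xs s

s : List (List ℕ) → List ℕ → List ℕ
s T π = run T π []

p123 p132 : List ℕ
p123 = 1 ∷ 2 ∷ 3 ∷ []
p132 = 1 ∷ 3 ∷ 2 ∷ []

Sₙ : ℕ → List ℕ → Set
Sₙ n π = π ↭ applyUpTo suc n

iter : {A : Set} → (A → A) → ℕ → A → A
iter f zero a = a
iter f (suc k) a = f (iter f k a)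

Periodic : {A : Set} → (A → A) → A → Set
Periodic f a = Σ ℕ λ k → (0 < k) × (iter f k a ≡ a)

InOrbit : {A : Set} → (A → A) → A → A → Set
InOrbit f a b = Σ ℕ λ i → iter f i a ≡ b

HasPeriodicOrbitCount : {A : Set} → (A → Set) → (A → A) → ℕ → Set
HasPeriodicOrbitCount {A} D f N =
  Σ (Fin N → A) λ r →
    ((i : Fin N) → D (r i) × Periodic f (r i)) ×
    ((i j : Fin N) → InOrbit f (r i) (r j) → i ≡ j) ×
    ((a : A) → D a → Periodic f a → ∃ λ (i : Fin N) → InOrbit f (r i) a)

module Submission where

-- With 𝒯 = {123, 132}, an entry can be pushed exactly when at most one entry already on the stack is
-- larger. Call a permutation woven if it reads C ++ k z₁ (k−1) z₂ ⋯ 1 z_k, where the labels 1, …, k are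
-- interleaved with zs = z₁ ⋯ z_k and all entries of C and zs exceed k; every permutation is woven with
-- k = 0. One application of s keeps a permutation woven: the head of C sinks to the bottom of the stack
-- and is appended to zs, the head of zs is appended to the (permuted) rest of C. While C has at least two
-- entries, the label k + 1 is eventually absorbed into the weave, which shortens C by two. Writing
-- n = e + 2d with e ∈ {1, 2}, every orbit therefore reaches woven permutations with |C| = e, and on these
-- s just rotates the list C ++ zs, a permutation of d + 1, …, n. So the periodic orbits correspond to the
-- cyclic arrangements of these e + d = ⌊n/2⌋ + 1 values, and there are ⌊n/2⌋! of them.

open import Defs
open import Data.Bool using (Bool; true; false; _∧_; _∨_; not; if_then_else_)
open import Data.Bool.ListAction using (any)
open import Data.Bool.Properties using (T-≡; ∧-zeroʳ; ∧-identityʳ; ∨-zeroʳ; ∨-identityʳ)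
open import Data.Empty using (⊥-elim)
open import Data.Fin using (Fin; zero; suc; remQuot; combine)
open import Data.Fin.Properties using (remQuot-combine; combine-remQuot)
open import Data.List
  using (List; []; _∷_; _++_; _∷ʳ_; map; length; applyUpTo; applyDownFrom; reverse; take; drop; initLast; _∷ʳ′_)
open import Data.List.Properties
  using (++-assoc; ++-identityʳ; ∷-injective; ∷ʳ-injective; length-++; length-++-sucʳ; length-take; length-drop;
         length-applyUpTo; applyUpTo-∷ʳ; reverse-applyUpTo; take++drop≡id)
open import Data.List.Membership.Propositional using (_∈_; _∉_)
open import Data.List.Membership.Propositional.Properties
  using (∈-++⁺ˡ; ∈-++⁺ʳ; ∈-++⁻; ∈-∃++; ∈-applyUpTo⁺)
open import Data.List.Relation.Unary.All as All using (All; []; _∷_)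
open import Data.List.Relation.Unary.All.Properties using (++⁺; ++⁻ˡ; ++⁻ʳ; ∷ʳ⁺; ∷ʳ⁻)
open import Data.List.Relation.Unary.Any using (here; there)
open import Data.List.Relation.Unary.Unique.Propositional using (Unique; []; _∷_)
open import Data.List.Relation.Unary.Unique.Propositional.Properties using (applyUpTo⁺₁)
open import Data.List.Relation.Binary.Permutation.Propositional
  using (_↭_; ↭-refl; ↭-sym; ↭-trans; ↭-prep; ↭-swap; ↭-reflexive; ↭⇒↭ₛ; module PermutationReasoning)
open import Data.List.Relation.Binary.Permutation.Propositional.Properties
  using (shift; shifts; ++⁺ˡ; ++⁺ʳ; ++-comm; drop-∷; drop-mid; All-resp-↭; ∈-resp-↭; ↭-length; ↭-empty-inv;
         ↭-singleton-inv; ↭-reverse; ∷↭∷ʳ)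
import Data.List.Relation.Binary.Permutation.Setoid.Properties as Permutationₛ
open import Data.Nat
  using (ℕ; zero; suc; _+_; _*_; _/_; _%_; _!; _<_; _≤_; _<ᵇ_; _∸_; z≤n; s≤s; s≤s⁻¹; ⌊_/2⌋)
open import Data.Nat.DivMod using (m≡m%n+[m/n]*n; m%n<n)
open import Data.Nat.Properties
  using (<⇒<ᵇ; <-cmp; <⇒≤; <⇒≢; <-trans; <-irrefl; n<1+n; ≤-refl; ≤-trans; ≤∧≢⇒<; m≤n⇒m≤1+n; m≤m+n; m≤n+m;
         m≤n⇒m⊓n≡m; +-comm; +-suc; +-identityʳ; +-monoˡ-≤; +-cancelˡ-≡; +-cancelʳ-≡; *-suc; m+n∸m≡n; suc-injective;
         n≡⌊n+n/2⌋)
open import Data.Nat.Tactic.RingSolver using (solve-∀)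
open import Data.Product using (Σ; _×_; _,_; proj₁; proj₂)
open import Data.Sum using (_⊎_; inj₁; inj₂)
open import Data.Vec using (Vec; []; _∷_; lookup; toList; removeAt) renaming (_∷ʳ_ to _∷ʳᵥ_)
open import Data.Vec.Properties using (toList-∷ʳ; length-toList)
open import Data.Vec.Membership.Propositional.Properties using (∈-lookup; ∈-toList⁺; ∈-toList⁻)
open import Data.Vec.Relation.Unary.Any using (index)
open import Data.Vec.Relation.Unary.Any.Properties using (lookup-index)
open import Function using (_∘_; _∘′_; Equivalence)
open import Relation.Binary.Definitions using (tri<; tri≈; tri>)
open import Relation.Binary.PropositionalEquality

variable
  E F : Set

iter-sucˡ : (f : E → E) (t : ℕ) (a : E) → iter f t (f a) ≡ iter f (suc t) a
iter-sucˡ f zero a = refl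
iter-sucˡ f (suc t) a = cong f (iter-sucˡ f t a)

iter-+ : (f : E → E) (s t : ℕ) (a : E) → iter f (t + s) a ≡ iter f t (iter f s a)
iter-+ f s zero a = refl
iter-+ f s (suc t) a = cong f (iter-+ f s t a)

iter-multiple : (f : E → E) (p : ℕ) (a : E) → iter f p a ≡ a → ∀ q → iter f (q * p) a ≡ a
iter-multiple f p a fix zero = refl
iter-multiple f p a fix (suc q) =
  trans (iter-+ f (q * p) p a) (trans (cong (iter f p) (iter-multiple f p a fix q)) fix)

periodic-return : (f : E → E) (p : ℕ) (a : E) → iter f (suc p) a ≡ a → ∀ t → iter f (t * p) (iter f t a) ≡ a
periodic-return f p a fix t = begin
  iter f (t * p) (iter f t a)  ≡⟨ iter-+ f t (t * p) a ⟨
  iter f (t * p + t) a         ≡⟨ cong (λ j → iter f j a) (trans (+-comm (t * p) t) (sym (*-suc t p))) ⟩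
  iter f (t * suc p) a         ≡⟨ iter-multiple f (suc p) a fix t ⟩
  a                            ∎
  where open ≡-Reasoning

length-∷ʳ : ∀ (xs : List ℕ) x → length (xs ∷ʳ x) ≡ suc (length xs)
length-∷ʳ xs x = trans (length-++-sucʳ xs x []) (cong (suc ∘′ length) (++-identityʳ xs))

take-length-++ : ∀ (C zs : List ℕ) → take (length C) (C ++ zs) ≡ C
take-length-++ [] zs = refl
take-length-++ (x ∷ C) zs = cong (x ∷_) (take-length-++ C zs)

drop-length-++ : ∀ (C zs : List ℕ) → drop (length C) (C ++ zs) ≡ zs
drop-length-++ [] zs = refl
drop-length-++ (x ∷ C) zs = drop-length-++ C zs

++-cancel-length : ∀ (A A′ : List ℕ) {B B′} → length A ≡ length A′ → A ++ B ≡ A′ ++ B′ → A ≡ A′ × B ≡ B′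
++-cancel-length [] [] len e = refl , e
++-cancel-length (a ∷ A) (a′ ∷ A′) len e with ∷-injective e
... | refl , e′ with ++-cancel-length A A′ (suc-injective len) e′
... | refl , refl = refl , refl

↭-cancelˡ : ∀ Y {X Z : List ℕ} → Y ++ X ↭ Y ++ Z → X ↭ Z
↭-cancelˡ [] p = p
↭-cancelˡ (y ∷ Y) p = ↭-cancelˡ Y (drop-∷ p)

1≤length-↭ : ∀ {Q C : List ℕ} → Q ↭ C → 1 ≤ length C → 1 ≤ length Q
1≤length-↭ Q↭C 1≤C rewrite ↭-length Q↭C = 1≤C

Unique-resp-↭ : {xs ys : List ℕ} → xs ↭ ys → Unique xs → Unique ys
Unique-resp-↭ p = Permutationₛ.Unique-resp-↭ (setoid ℕ) (↭⇒↭ₛ p)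

Unique-++⁻ˡ : ∀ xs {ys : List ℕ} → Unique (xs ++ ys) → Unique xs
Unique-++⁻ˡ [] u = []
Unique-++⁻ˡ (x ∷ xs) (x≢ ∷ u) = ++⁻ˡ xs x≢ ∷ Unique-++⁻ˡ xs u

Unique-++⁻ʳ : ∀ xs {ys : List ℕ} → Unique (xs ++ ys) → Unique ys
Unique-++⁻ʳ [] u = u
Unique-++⁻ʳ (x ∷ xs) (_ ∷ u) = Unique-++⁻ʳ xs u

Unique-middle : ∀ xs y {ys : List ℕ} → Unique (xs ++ y ∷ ys) → All (y ≢_) (xs ++ ys)
Unique-middle xs y {ys} u with Unique-resp-↭ (shift y xs ys) u
... | y≢ ∷ _ = y≢

Unique-skip : ∀ x xs {st : List ℕ} → Unique (x ∷ xs ++ st) → Unique (x ∷ st)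
Unique-skip x xs {st} u = Unique-++⁻ʳ xs (Unique-resp-↭ (↭-sym (shift x xs st)) u)

All->-suc : ∀ {k} {L : List ℕ} → All (k <_) L → All (suc k ≢_) L → All (suc k <_) L
All->-suc k<L sk≢L = All.zipWith (λ (k<x , sk≢x) → ≤∧≢⇒< k<x sk≢x) (k<L , sk≢L)

double-injective : ∀ {x y} → x + x ≡ y + y → x ≡ y
double-injective {x} {y} eq = trans (n≡⌊n+n/2⌋ x) (trans (cong ⌊_/2⌋ eq) (sym (n≡⌊n+n/2⌋ y)))

any-++ : (f : E → Bool) (xs ys : List E) → any f (xs ++ ys) ≡ any f xs ∨ any f ys
any-++ f [] ys = refl
any-++ f (x ∷ xs) ys with f x
... | true  = refl
... | false = any-++ f xs ys

any-map : (f : F → Bool) (g : E → F) (xs : List E) → any f (map g xs) ≡ any (f ∘ g) xs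
any-map f g [] = refl
any-map f g (x ∷ xs) = cong (f (g x) ∨_) (any-map f g xs)

any-false : (f : E → Bool) (xs : List E) → (∀ a → f a ≡ false) → any f xs ≡ false
any-false f [] h = refl
any-false f (x ∷ xs) h rewrite h x = any-false f xs h

any-cong : (f g : E → Bool) (xs : List E) → (∀ a → a ∈ xs → f a ≡ g a) → any f xs ≡ any g xs
any-cong f g [] h = refl
any-cong f g (x ∷ xs) h rewrite h x (here refl) = cong (g x ∨_) (any-cong f g xs (λ a → h a ∘ there))

any-∨ : (f g : E → Bool) (xs : List E) → any f xs ∨ any g xs ≡ any (λ a → f a ∨ g a) xs
any-∨ f g [] = refl
any-∨ f g (x ∷ xs) with f x | g x
... | true  | _     = refl
... | false | true  = ∨-zeroʳ (any f xs)
... | false | false = any-∨ f g xs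

any-∧ˡ : (p : Bool) (f : E → Bool) (xs : List E) → any (λ a → p ∧ f a) xs ≡ p ∧ any f xs
any-∧ˡ false f xs = any-false _ xs (λ _ → refl)
any-∧ˡ true  f xs = refl

any-subseqs-∷ : (f : List ℕ → Bool) (x : ℕ) (L : List ℕ) →
  any f (subseqs (x ∷ L)) ≡ any (f ∘ (x ∷_)) (subseqs L) ∨ any f (subseqs L)
any-subseqs-∷ f x L =
  trans (any-++ f (map (x ∷_) (subseqs L)) (subseqs L))
        (cong (_∨ any f (subseqs L)) (any-map f (x ∷_) (subseqs L)))

any-subseqs-extending : (h : List ℕ → Bool) (b : ℕ) (L : List ℕ) → (∀ c r → h (b ∷ c ∷ r) ≡ false) →
  any (h ∘ (b ∷_)) (subseqs L) ≡ h (b ∷ [])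
any-subseqs-extending h b [] hf = ∨-identityʳ _
any-subseqs-extending h b (c ∷ L) hf
  rewrite any-subseqs-∷ (h ∘ (b ∷_)) c L | any-false (h ∘ (b ∷_) ∘ (c ∷_)) (subseqs L) (hf c) =
  any-subseqs-extending h b L hf

any-subseqs-singletons : (h : List ℕ → Bool) (L : List ℕ) →
  h [] ≡ false → (∀ b c r → h (b ∷ c ∷ r) ≡ false) → any h (subseqs L) ≡ any (λ b → h (b ∷ [])) L
any-subseqs-singletons h [] h0 hf rewrite h0 = refl
any-subseqs-singletons h (b ∷ L) h0 hf
  rewrite any-subseqs-∷ h b L | any-subseqs-extending h b L (hf b) | any-subseqs-singletons h L h0 hf = refl

<ᵇ-true : ∀ {a b} → a < b → (a <ᵇ b) ≡ true
<ᵇ-true = Equivalence.to T-≡ ∘ <⇒<ᵇ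

<ᵇ-false : ∀ {a b} → b ≤ a → (a <ᵇ b) ≡ false
<ᵇ-false {a} {zero} _ = refl
<ᵇ-false {suc a} {suc b} (s≤s b≤a) = <ᵇ-false b≤a

<ᵇ-flip : ∀ a b → a ≢ b → (b <ᵇ a) ≡ not (a <ᵇ b)
<ᵇ-flip a b a≢b with <-cmp a b
... | tri< a<b _ _ rewrite <ᵇ-true a<b | <ᵇ-false (<⇒≤ a<b) = refl
... | tri≈ _ a≡b _ = ⊥-elim (a≢b a≡b)
... | tri> _ _ b<a rewrite <ᵇ-true b<a | <ᵇ-false (<⇒≤ b<a) = refl

orderIsoᵇ-length≢ : ∀ xs ys → length xs ≢ length ys → orderIsoᵇ xs ys ≡ false
orderIsoᵇ-length≢ [] [] ne = ⊥-elim (ne refl)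
orderIsoᵇ-length≢ [] (_ ∷ _) ne = refl
orderIsoᵇ-length≢ (_ ∷ _) [] ne = refl
orderIsoᵇ-length≢ (x ∷ xs) (y ∷ ys) ne rewrite orderIsoᵇ-length≢ xs ys (ne ∘ cong suc) = ∧-zeroʳ _

-- The stack criterion for 𝒯 = {123, 132}

𝒯 : List (List ℕ)
𝒯 = p123 ∷ p132 ∷ []

is𝒯 : List ℕ → Bool
is𝒯 σ = orderIsoᵇ σ p123 ∨ orderIsoᵇ σ p132

is𝒯-length≢3 : ∀ σ → length σ ≢ 3 → is𝒯 σ ≡ false
is𝒯-length≢3 σ ne rewrite orderIsoᵇ-length≢ σ p123 ne | orderIsoᵇ-length≢ σ p132 ne = refl

is𝒯-triple : ∀ x y b → x ≢ y → x ≢ b → y ≢ b → is𝒯 (x ∷ y ∷ b ∷ []) ≡ (x <ᵇ y) ∧ (x <ᵇ b)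
is𝒯-triple x y b x≢y x≢b y≢b rewrite <ᵇ-flip x y x≢y | <ᵇ-flip x b x≢b | <ᵇ-flip y b y≢b
  with x <ᵇ y | x <ᵇ b | y <ᵇ b
... | true  | true  | true  = refl
... | true  | true  | false = refl
... | true  | false | true  = refl
... | true  | false | false = refl
... | false | true  | true  = refl
... | false | true  | false = refl
... | false | false | true  = refl
... | false | false | false = refl

avoids𝒯 : ∀ σ → avoidsᵇ 𝒯 σ ≡ not (any is𝒯 (subseqs σ))
avoids𝒯 σ = trans (deMorgan (containsᵇ σ p123) (containsᵇ σ p132))
                  (cong not (any-∨ (λ s → orderIsoᵇ s p123) (λ s → orderIsoᵇ s p132) (subseqs σ)))
  where
  deMorgan : ∀ a b → not a ∧ (not b ∧ true) ≡ not (a ∨ b)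
  deMorgan true  b     = refl
  deMorgan false true  = refl
  deMorgan false false = refl

countAbove : ℕ → List ℕ → ℕ
countAbove x [] = 0
countAbove x (y ∷ ys) = if x <ᵇ y then suc (countAbove x ys) else countAbove x ys

canPush : ℕ → List ℕ → Bool
canPush x st = countAbove x st <ᵇ 2

any-<ᵇ : ∀ x L → any (x <ᵇ_) L ≡ (0 <ᵇ countAbove x L)
any-<ᵇ x [] = refl
any-<ᵇ x (y ∷ L) with x <ᵇ y
... | true  = refl
... | false = any-<ᵇ x L

-- An occurrence of 123 or 132 that starts with x is x followed by two larger entries.
any-is𝒯-∷ : ∀ x L → Unique (x ∷ L) → any (is𝒯 ∘ (x ∷_)) (subseqs L) ≡ not (canPush x L)
any-is𝒯-∷ x [] u = refl
any-is𝒯-∷ x (y ∷ L) ((x≢y ∷ x≢L) ∷ y≢L ∷ u) = begin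
  any (is𝒯 ∘ (x ∷_)) (subseqs (y ∷ L))
    ≡⟨ any-subseqs-∷ (is𝒯 ∘ (x ∷_)) y L ⟩
  any (λ s → is𝒯 (x ∷ y ∷ s)) (subseqs L) ∨ any (is𝒯 ∘ (x ∷_)) (subseqs L)
    ≡⟨ cong₂ _∨_ through-y (any-is𝒯-∷ x L (x≢L ∷ u)) ⟩
  ((x <ᵇ y) ∧ (0 <ᵇ countAbove x L)) ∨ not (canPush x L)
    ≡⟨ canPush-step (x <ᵇ y) (countAbove x L) ⟩
  not (canPush x (y ∷ L)) ∎
  where
  open ≡-Reasoning
  through-y : any (λ s → is𝒯 (x ∷ y ∷ s)) (subseqs L) ≡ (x <ᵇ y) ∧ (0 <ᵇ countAbove x L)
  through-y = begin
    any (λ s → is𝒯 (x ∷ y ∷ s)) (subseqs L)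
      ≡⟨ any-subseqs-singletons (λ s → is𝒯 (x ∷ y ∷ s)) L (is𝒯-length≢3 (x ∷ y ∷ []) λ ())
           (λ b c r → is𝒯-length≢3 (x ∷ y ∷ b ∷ c ∷ r) λ ()) ⟩
    any (λ b → is𝒯 (x ∷ y ∷ b ∷ [])) L
      ≡⟨ any-cong _ _ L (λ b b∈L → is𝒯-triple x y b x≢y (All.lookup x≢L b∈L) (All.lookup y≢L b∈L)) ⟩
    any (λ b → (x <ᵇ y) ∧ (x <ᵇ b)) L
      ≡⟨ any-∧ˡ (x <ᵇ y) (x <ᵇ_) L ⟩
    (x <ᵇ y) ∧ any (x <ᵇ_) L
      ≡⟨ cong ((x <ᵇ y) ∧_) (any-<ᵇ x L) ⟩
    (x <ᵇ y) ∧ (0 <ᵇ countAbove x L) ∎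
  canPush-step : ∀ p c → (p ∧ (0 <ᵇ c)) ∨ not (c <ᵇ 2) ≡ not ((if p then suc c else c) <ᵇ 2)
  canPush-step false c = refl
  canPush-step true zero = refl
  canPush-step true (suc zero) = refl
  canPush-step true (suc (suc c)) = refl

avoids𝒯-∷ : ∀ x L → Unique (x ∷ L) → avoidsᵇ 𝒯 (x ∷ L) ≡ avoidsᵇ 𝒯 L ∧ canPush x L
avoids𝒯-∷ x L u
  rewrite avoids𝒯 (x ∷ L) | avoids𝒯 L | any-subseqs-∷ is𝒯 x L | any-is𝒯-∷ x L u
  with canPush x L | any is𝒯 (subseqs L)
... | true  | b = sym (∧-identityʳ (not b))
... | false | b = sym (∧-zeroʳ (not b))

avoids𝒯-tail : ∀ y ys → Unique (y ∷ ys) → avoidsᵇ 𝒯 (y ∷ ys) ≡ true → avoidsᵇ 𝒯 ys ≡ true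
avoids𝒯-tail y ys u a with avoidsᵇ 𝒯 ys | avoids𝒯-∷ y ys u
... | true  | _ = refl
... | false | e = trans (sym e) a

-- The sorting map s_𝒯 on permutations

pushPop′ : ℕ → List ℕ → List ℕ × List ℕ
pushPop′ x [] = [] , x ∷ []
pushPop′ x (y ∷ ys) =
  if canPush x (y ∷ ys) then ([] , x ∷ y ∷ ys)
  else (y ∷ proj₁ (pushPop′ x ys) , proj₂ (pushPop′ x ys))

run′ : List ℕ → List ℕ → List ℕ
run′ [] st = st
run′ (x ∷ xs) st = proj₁ (pushPop′ x st) ++ run′ xs (proj₂ (pushPop′ x st))

s′ : List ℕ → List ℕ
s′ w = run′ w []

pushPop′-pops-prefix : ∀ x st → Σ (List ℕ) λ p → Σ (List ℕ) λ r →
  pushPop′ x st ≡ (p , x ∷ r) × p ++ r ≡ st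
pushPop′-pops-prefix x [] = [] , [] , refl , refl
pushPop′-pops-prefix x (y ∷ ys) with canPush x (y ∷ ys)
... | true = [] , y ∷ ys , refl , refl
... | false with pushPop′-pops-prefix x ys
... | p , r , e , p++r≡ys rewrite e = y ∷ p , r , refl , cong (y ∷_) p++r≡ys

pushPop≡pushPop′ : ∀ x st → Unique (x ∷ st) → avoidsᵇ 𝒯 st ≡ true → pushPop 𝒯 x st ≡ pushPop′ x st
pushPop≡pushPop′ x [] u a = refl
pushPop≡pushPop′ x (y ∷ ys) u@((_ ∷ x≢ys) ∷ uy@(_ ∷ uys)) a
  with avoidsᵇ 𝒯 (x ∷ y ∷ ys) | avoids𝒯-∷ x (y ∷ ys) u
... | true  | e rewrite a | sym e = refl
... | false | e rewrite a | sym e | pushPop≡pushPop′ x ys (x≢ys ∷ uys) (avoids𝒯-tail y ys uy a) = refl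

pushPop′-avoids : ∀ x st → Unique (x ∷ st) → avoidsᵇ 𝒯 st ≡ true → avoidsᵇ 𝒯 (proj₂ (pushPop′ x st)) ≡ true
pushPop′-avoids x [] u a = refl
pushPop′-avoids x (y ∷ ys) u@((_ ∷ x≢ys) ∷ uy@(_ ∷ uys)) a with canPush x (y ∷ ys) in push
... | true rewrite avoids𝒯-∷ x (y ∷ ys) u | a | push = refl
... | false = pushPop′-avoids x ys (x≢ys ∷ uys) (avoids𝒯-tail y ys uy a)

run≡run′ : ∀ xs st → Unique (xs ++ st) → avoidsᵇ 𝒯 st ≡ true → run 𝒯 xs st ≡ run′ xs st
run≡run′ [] st u a = refl
run≡run′ (x ∷ xs) st u a with pushPop′-pops-prefix x st
... | p , r , e , refl rewrite pushPop≡pushPop′ x st (Unique-skip x xs u) a | e =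
  cong (p ++_) (run≡run′ xs (x ∷ r) (Unique-++⁻ˡ (xs ++ x ∷ r) (Unique-resp-↭ reorder u)) avoids-x∷r)
  where
  reorder : x ∷ xs ++ p ++ r ↭ (xs ++ x ∷ r) ++ p
  reorder = begin
    x ∷ xs ++ p ++ r   ↭⟨ ↭-prep x (++⁺ˡ xs (++-comm p r)) ⟩
    x ∷ xs ++ r ++ p   ↭⟨ shift x xs (r ++ p) ⟨
    xs ++ x ∷ r ++ p   ≡⟨ ++-assoc xs (x ∷ r) p ⟨
    (xs ++ x ∷ r) ++ p ∎
    where open PermutationReasoning
  avoids-x∷r : avoidsᵇ 𝒯 (x ∷ r) ≡ true
  avoids-x∷r = subst (λ pp → avoidsᵇ 𝒯 (proj₂ pp) ≡ true) e (pushPop′-avoids x (p ++ r) (Unique-skip x xs u) a)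

s≡s′ : ∀ π → Unique π → s 𝒯 π ≡ s′ π
s≡s′ π u = run≡run′ π [] (subst Unique (sym (++-identityʳ π)) u) refl

output : List ℕ → List ℕ → List ℕ
output [] st = []
output (x ∷ xs) st = proj₁ (pushPop′ x st) ++ output xs (proj₂ (pushPop′ x st))

stackAfter : List ℕ → List ℕ → List ℕ
stackAfter [] st = st
stackAfter (x ∷ xs) st = stackAfter xs (proj₂ (pushPop′ x st))

run′-++ : ∀ A B st → run′ (A ++ B) st ≡ output A st ++ run′ B (stackAfter A st)
run′-++ [] B st = refl
run′-++ (x ∷ A) B st rewrite run′-++ A B (proj₂ (pushPop′ x st)) =
  sym (++-assoc (proj₁ (pushPop′ x st)) _ _)

run′≡output++stackAfter : ∀ A st → run′ A st ≡ output A st ++ stackAfter A st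
run′≡output++stackAfter A st = trans (cong (λ A′ → run′ A′ st) (sym (++-identityʳ A))) (run′-++ A [] st)

run′-↭ : ∀ xs st → run′ xs st ↭ xs ++ st
run′-↭ [] st = ↭-refl
run′-↭ (x ∷ xs) st with pushPop′-pops-prefix x st
... | p , r , e , refl rewrite e = begin
  p ++ run′ xs (x ∷ r)  ↭⟨ ++⁺ˡ p (run′-↭ xs (x ∷ r)) ⟩
  p ++ xs ++ x ∷ r      ↭⟨ shifts p xs ⟩
  xs ++ p ++ x ∷ r      ↭⟨ ++⁺ˡ xs (shift x p r) ⟩
  xs ++ x ∷ p ++ r      ↭⟨ shift x xs (p ++ r) ⟩
  x ∷ xs ++ p ++ r      ∎
  where open PermutationReasoning

s′-↭ : ∀ w → s′ w ↭ w
s′-↭ w = ↭-trans (run′-↭ w []) (↭-reflexive (++-identityʳ w))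

All-run′ : ∀ {P : ℕ → Set} xs st → All P xs → All P st → All P (run′ xs st)
All-run′ xs st Pxs Pst = All-resp-↭ (↭-sym (run′-↭ xs st)) (++⁺ Pxs Pst)

All-stackAfter : ∀ {P : ℕ → Set} xs st → All P xs → All P st → All P (stackAfter xs st)
All-stackAfter xs st Pxs Pst =
  ++⁻ʳ (output xs st) (subst (All _) (run′≡output++stackAfter xs st) (All-run′ xs st Pxs Pst))

countAbove-all : ∀ x L → All (x <_) L → countAbove x L ≡ length L
countAbove-all x [] [] = refl
countAbove-all x (y ∷ L) (x<y ∷ x<L) rewrite <ᵇ-true x<y = cong suc (countAbove-all x L x<L)

canPush-[_] : ∀ h {x} → canPush x (h ∷ []) ≡ true
canPush-[ h ] {x} with x <ᵇ h
... | true  = refl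
... | false = refl

canPush-floor : ∀ {x μ} h → μ < x → canPush x (μ ∷ h ∷ []) ≡ true
canPush-floor h μ<x rewrite <ᵇ-false (<⇒≤ μ<x) = canPush-[ h ]

pushPop′-under : ∀ x S h → All (x <_) S → x < h → pushPop′ x (S ∷ʳ h) ≡ (S , x ∷ h ∷ [])
pushPop′-under x [] h [] x<h rewrite <ᵇ-true x<h = refl
pushPop′-under x (y ∷ S) h (x<y ∷ x<S) x<h
  rewrite countAbove-all x (y ∷ S ∷ʳ h) (x<y ∷ ∷ʳ⁺ x<S x<h) | length-∷ʳ S h
        | pushPop′-under x S h x<S x<h = refl

pushPop′-keeps : ∀ x S B → canPush x B ≡ true →
  Σ (List ℕ) λ p → Σ (List ℕ) λ S′ → pushPop′ x (S ++ B) ≡ (p , x ∷ S′ ++ B)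
pushPop′-keeps x [] [] push = [] , [] , refl
pushPop′-keeps x [] (b ∷ B) push rewrite push = [] , [] , refl
pushPop′-keeps x (y ∷ S) B push with canPush x (y ∷ S ++ B)
... | true = [] , y ∷ S , refl
... | false with pushPop′-keeps x S B push
... | p , S′ , e rewrite e = y ∷ p , S′ , refl

run′-keeps : ∀ xs S B → All (λ x → canPush x B ≡ true) xs →
  Σ (List ℕ) λ o → run′ xs (S ++ B) ≡ o ++ B
run′-keeps [] S B [] = S , refl
run′-keeps (x ∷ xs) S B (push ∷ pushes) with pushPop′-keeps x S B push
... | p , S′ , e rewrite e with run′-keeps xs (x ∷ S′) B pushes
... | o , e′ rewrite e′ = p ++ o , sym (++-assoc p o B)

stackAfter-keeps : ∀ xs S B → All (λ x → canPush x B ≡ true) xs →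
  Σ (List ℕ) λ S′ → stackAfter xs (S ++ B) ≡ S′ ++ B
stackAfter-keeps [] S B [] = S , refl
stackAfter-keeps (x ∷ xs) S B (push ∷ pushes) with pushPop′-keeps x S B push
... | p , S′ , e rewrite e = stackAfter-keeps xs (x ∷ S′) B pushes

stackAfter-keeps-bottom : ∀ xs h → Σ (List ℕ) λ S′ → stackAfter xs (h ∷ []) ≡ S′ ∷ʳ h
stackAfter-keeps-bottom xs h = stackAfter-keeps xs [] (h ∷ []) (All.universal (λ _ → canPush-[ h ]) xs)

-- Woven permutations

weave : List ℕ → List ℕ
weave [] = []
weave (z ∷ zs) = suc (length zs) ∷ z ∷ weave zs

weave′ : List ℕ → List ℕ
weave′ [] = []
weave′ (z ∷ zs) = z ∷ suc (length zs) ∷ weave′ zs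

weave-∷ʳ : ∀ zs h → weave (zs ∷ʳ h) ≡ suc (length zs) ∷ weave′ zs ∷ʳ h
weave-∷ʳ [] h = refl
weave-∷ʳ (z ∷ zs) h rewrite weave-∷ʳ zs h | length-∷ʳ zs h = refl

weave-injective : ∀ zs zs′ → weave zs ≡ weave zs′ → zs ≡ zs′
weave-injective [] [] e = refl
weave-injective (z ∷ zs) (z′ ∷ zs′) e with ∷-injective e
... | _ , e′ with ∷-injective e′
... | refl , e″ = cong (z ∷_) (weave-injective zs zs′ e″)

length-weave : ∀ zs → length (weave zs) ≡ length zs + length zs
length-weave [] = refl
length-weave (z ∷ zs) rewrite length-weave zs | +-suc (length zs) (length zs) = refl

All-weave⁻ : ∀ {P : ℕ → Set} zs → All P (weave zs) → All P zs
All-weave⁻ [] [] = []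
All-weave⁻ (z ∷ zs) (_ ∷ Pz ∷ Pzs) = Pz ∷ All-weave⁻ zs Pzs

∈-weave⁻ : ∀ x zs → x ∈ weave zs → x ≤ length zs ⊎ x ∈ zs
∈-weave⁻ x (z ∷ zs) (here refl) = inj₁ ≤-refl
∈-weave⁻ x (z ∷ zs) (there (here refl)) = inj₂ (here refl)
∈-weave⁻ x (z ∷ zs) (there (there x∈)) with ∈-weave⁻ x zs x∈
... | inj₁ x≤ = inj₁ (m≤n⇒m≤1+n x≤)
... | inj₂ x∈zs = inj₂ (there x∈zs)

run′-weave : ∀ zs S h → All (length zs <_) S → length zs < h → All (length zs <_) zs →
  run′ (weave zs) (S ∷ʳ h) ≡ S ++ weave′ zs ∷ʳ h
run′-weave [] S h k<S k<h k<zs = refl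
run′-weave (z ∷ zs) S h k<S k<h (k<z ∷ k<zs)
  rewrite pushPop′-under (suc (length zs)) S h k<S k<h
        | <ᵇ-false (<⇒≤ k<z) | canPush-[ h ] {z}
        | run′-weave zs (z ∷ suc (length zs) ∷ []) h
            (<-trans (n<1+n _) k<z ∷ n<1+n _ ∷ []) (<-trans (n<1+n _) k<h)
            (All.map (<-trans (n<1+n _)) k<zs)
        = refl

run′-prefix-weave : ∀ C′ h zs → All (length zs <_) C′ → length zs < h → All (length zs <_) zs →
  Σ (List ℕ) λ Q → run′ (C′ ++ weave zs) (h ∷ []) ≡ Q ++ weave′ zs ∷ʳ h × run′ C′ (h ∷ []) ≡ Q ∷ʳ h
run′-prefix-weave C′ h zs k<C′ k<h k<zs with stackAfter-keeps-bottom C′ h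
... | S′ , e = output C′ (h ∷ []) ++ S′ , through-weave , through-prefix
  where
  open ≡-Reasoning
  k<S′ : All (length zs <_) S′
  k<S′ = proj₁ (∷ʳ⁻ (subst (All _) e (All-stackAfter C′ (h ∷ []) k<C′ (k<h ∷ []))))
  through-weave : run′ (C′ ++ weave zs) (h ∷ []) ≡ (output C′ (h ∷ []) ++ S′) ++ weave′ zs ∷ʳ h
  through-weave = begin
    run′ (C′ ++ weave zs) (h ∷ [])
      ≡⟨ run′-++ C′ (weave zs) (h ∷ []) ⟩
    output C′ (h ∷ []) ++ run′ (weave zs) (stackAfter C′ (h ∷ []))
      ≡⟨ cong (λ st → output C′ (h ∷ []) ++ run′ (weave zs) st) e ⟩
    output C′ (h ∷ []) ++ run′ (weave zs) (S′ ∷ʳ h)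
      ≡⟨ cong (output C′ (h ∷ []) ++_) (run′-weave zs S′ h k<S′ k<h k<zs) ⟩
    output C′ (h ∷ []) ++ S′ ++ weave′ zs ∷ʳ h
      ≡⟨ ++-assoc (output C′ (h ∷ [])) S′ _ ⟨
    (output C′ (h ∷ []) ++ S′) ++ weave′ zs ∷ʳ h ∎
  through-prefix : run′ C′ (h ∷ []) ≡ (output C′ (h ∷ []) ++ S′) ∷ʳ h
  through-prefix = begin
    run′ C′ (h ∷ [])                              ≡⟨ run′≡output++stackAfter C′ (h ∷ []) ⟩
    output C′ (h ∷ []) ++ stackAfter C′ (h ∷ [])  ≡⟨ cong (output C′ (h ∷ []) ++_) e ⟩
    output C′ (h ∷ []) ++ S′ ∷ʳ h                 ≡⟨ ++-assoc (output C′ (h ∷ [])) S′ _ ⟨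
    (output C′ (h ∷ []) ++ S′) ∷ʳ h               ∎

run′-over-bottom-↭ : ∀ C′ h Q → run′ C′ (h ∷ []) ≡ Q ∷ʳ h → Q ↭ C′
run′-over-bottom-↭ C′ h Q e = begin
  Q            ≡⟨ ++-identityʳ Q ⟨
  Q ++ []      ↭⟨ drop-mid Q C′ (↭-trans (↭-reflexive (sym e)) (run′-↭ C′ (h ∷ []))) ⟩
  C′ ++ []     ≡⟨ ++-identityʳ C′ ⟩
  C′           ∎
  where open PermutationReasoning

run′-new-floor : ∀ A μ R h → μ < h → All (μ <_) A → All (μ <_) R →
  Σ (List ℕ) λ X → run′ (A ++ μ ∷ R) (h ∷ []) ≡ X ++ μ ∷ h ∷ []
run′-new-floor A μ R h μ<h μ<A μ<R
  with stackAfter-keeps-bottom A h | run′-keeps R [] (μ ∷ h ∷ []) (All.map (canPush-floor h) μ<R)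
... | S , e | o , e′ = output A (h ∷ []) ++ S ++ o , (begin
  run′ (A ++ μ ∷ R) (h ∷ [])
    ≡⟨ run′-++ A (μ ∷ R) (h ∷ []) ⟩
  output A (h ∷ []) ++ run′ (μ ∷ R) (stackAfter A (h ∷ []))
    ≡⟨ cong (λ st → output A (h ∷ []) ++ run′ (μ ∷ R) st) e ⟩
  output A (h ∷ []) ++ run′ (μ ∷ R) (S ∷ʳ h)
    ≡⟨ cong (λ pp → output A (h ∷ []) ++ proj₁ pp ++ run′ R (proj₂ pp)) (pushPop′-under μ S h μ<S μ<h) ⟩
  output A (h ∷ []) ++ S ++ run′ R (μ ∷ h ∷ [])
    ≡⟨ cong (λ t → output A (h ∷ []) ++ S ++ t) e′ ⟩
  output A (h ∷ []) ++ S ++ o ++ μ ∷ h ∷ []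
    ≡⟨ cong (output A (h ∷ []) ++_) (++-assoc S o _) ⟨
  output A (h ∷ []) ++ (S ++ o) ++ μ ∷ h ∷ []
    ≡⟨ ++-assoc (output A (h ∷ [])) (S ++ o) _ ⟨
  (output A (h ∷ []) ++ S ++ o) ++ μ ∷ h ∷ [] ∎)
  where
  open ≡-Reasoning
  μ<S : All (μ <_) S
  μ<S = proj₁ (∷ʳ⁻ (subst (All _) e (All-stackAfter A (h ∷ []) μ<A (μ<h ∷ []))))

upTo₁ : ℕ → List ℕ
upTo₁ n = applyUpTo suc n

Unique-upTo₁ : ∀ n → Unique (upTo₁ n)
Unique-upTo₁ n = applyUpTo⁺₁ suc n (λ i<j _ → <⇒≢ (s≤s i<j))

WovenPerm : ℕ → List ℕ → List ℕ → Set
WovenPerm n C zs = All (length zs <_) (C ++ zs) × C ++ weave zs ↭ upTo₁ n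

length-WovenPerm : ∀ {n} C zs → WovenPerm n C zs → length C + (length zs + length zs) ≡ n
length-WovenPerm {n} C zs (_ , w↭) = begin
  length C + (length zs + length zs)  ≡⟨ cong (length C +_) (length-weave zs) ⟨
  length C + length (weave zs)        ≡⟨ length-++ C ⟨
  length (C ++ weave zs)              ≡⟨ ↭-length w↭ ⟩
  length (upTo₁ n)                    ≡⟨ length-applyUpTo suc n ⟩
  n                                   ∎
  where open ≡-Reasoning

WovenPerm-s′ : ∀ {n} C zs C₂ zs₂ → WovenPerm n C zs → s′ (C ++ weave zs) ≡ C₂ ++ weave zs₂ →
  All (length zs₂ <_) (C₂ ++ zs₂) → WovenPerm n C₂ zs₂
WovenPerm-s′ C zs C₂ zs₂ (_ , w↭) e bound =
  bound , ↭-trans (↭-reflexive (sym e)) (↭-trans (s′-↭ (C ++ weave zs)) w↭)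

nextLabel-∈ : ∀ {n} C zs → WovenPerm n C zs → suc (length zs) ≤ n → suc (length zs) ∈ C ++ zs
nextLabel-∈ C zs (_ , w↭) k<n with ∈-++⁻ C (∈-resp-↭ (↭-sym w↭) (∈-applyUpTo⁺ suc k<n))
... | inj₁ ∈C = ∈-++⁺ˡ ∈C
... | inj₂ ∈weave with ∈-weave⁻ _ zs ∈weave
... | inj₁ k<k = ⊥-elim (<-irrefl refl k<k)
... | inj₂ ∈zs = ∈-++⁺ʳ C ∈zs

sinkHead : ∀ {n} h C′ zs → WovenPerm n (h ∷ C′) zs →
  Σ (List ℕ) λ Q → Q ↭ C′ × s′ (h ∷ C′ ++ weave zs) ≡ Q ++ weave′ zs ∷ʳ h
sinkHead h C′ zs (k<h ∷ k<C′++zs , _)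
  with run′-prefix-weave C′ h zs (++⁻ˡ C′ k<C′++zs) k<h (++⁻ʳ C′ k<C′++zs)
... | Q , through-weave , through-prefix = Q , run′-over-bottom-↭ C′ h Q through-prefix , through-weave

step-[] : ∀ {n} h C′ → WovenPerm n (h ∷ C′) [] →
  Σ (List ℕ) λ Q → Q ↭ C′ × s′ ((h ∷ C′) ++ weave []) ≡ (Q ∷ʳ h) ++ weave [] × WovenPerm n (Q ∷ʳ h) []
step-[] h C′ wp@(0<h ∷ 0<C′ , _) with sinkHead h C′ [] wp
... | Q , Q↭C′ , e = Q , Q↭C′ , e′ , WovenPerm-s′ (h ∷ C′) [] (Q ∷ʳ h) [] wp e′ (++⁺ (∷ʳ⁺ 0<Q 0<h) [])
  where
  e′ : s′ ((h ∷ C′) ++ weave []) ≡ (Q ∷ʳ h) ++ weave []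
  e′ = trans e (sym (++-identityʳ (Q ∷ʳ h)))
  0<Q : All (0 <_) Q
  0<Q = All-resp-↭ (↭-sym Q↭C′) (++⁻ˡ C′ 0<C′)

step-∷ : ∀ {n} h C′ z zs → WovenPerm n (h ∷ C′) (z ∷ zs) →
  Σ (List ℕ) λ Q → Q ↭ C′ × s′ ((h ∷ C′) ++ weave (z ∷ zs)) ≡ (Q ∷ʳ z) ++ weave (zs ∷ʳ h)
    × WovenPerm n (Q ∷ʳ z) (zs ∷ʳ h)
step-∷ h C′ z zs wp@(k<h ∷ k<C′++zs , _) with sinkHead h C′ (z ∷ zs) wp
... | Q , Q↭C′ , e = Q , Q↭C′ , e′ , WovenPerm-s′ (h ∷ C′) (z ∷ zs) (Q ∷ʳ z) (zs ∷ʳ h) wp e′ bound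
  where
  e′ : s′ ((h ∷ C′) ++ weave (z ∷ zs)) ≡ (Q ∷ʳ z) ++ weave (zs ∷ʳ h)
  e′ = begin
    s′ ((h ∷ C′) ++ weave (z ∷ zs))            ≡⟨ e ⟩
    Q ++ z ∷ suc (length zs) ∷ weave′ zs ∷ʳ h  ≡⟨ cong (λ t → Q ++ z ∷ t) (weave-∷ʳ zs h) ⟨
    Q ++ z ∷ weave (zs ∷ʳ h)                   ≡⟨ ++-assoc Q (z ∷ []) _ ⟨
    (Q ∷ʳ z) ++ weave (zs ∷ʳ h)                ∎
    where open ≡-Reasoning
  k<z∷zs : All (suc (length zs) <_) (z ∷ zs)
  k<z∷zs = ++⁻ʳ C′ k<C′++zs
  bound : All (length (zs ∷ʳ h) <_) ((Q ∷ʳ z) ++ zs ∷ʳ h)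
  bound rewrite length-∷ʳ zs h =
    ++⁺ (∷ʳ⁺ (All-resp-↭ (↭-sym Q↭C′) (++⁻ˡ C′ k<C′++zs)) (All.head k<z∷zs)) (∷ʳ⁺ (All.tail k<z∷zs) k<h)

nextLabel-least : ∀ {n} h A R zs → WovenPerm n (h ∷ A ++ suc (length zs) ∷ R) zs →
  suc (length zs) < h × All (suc (length zs) <_) (A ++ R) × All (suc (length zs) <_) zs
nextLabel-least {n} h A R zs (k<h ∷ k<C′++zs , w↭) with unique
  where
  unique : Unique (h ∷ A ++ suc (length zs) ∷ R ++ weave zs)
  unique = subst (λ t → Unique (h ∷ t)) (++-assoc A (suc (length zs) ∷ R) (weave zs))
             (Unique-resp-↭ (↭-sym w↭) (Unique-upTo₁ n))
... | h≢ ∷ u with Unique-middle A (suc (length zs)) u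
... | μ≢A++R++weave =
  ≤∧≢⇒< k<h (λ μ≡h → All.lookup h≢ (∈-++⁺ʳ A (here refl)) (sym μ≡h)) ,
  ++⁺ (All->-suc (++⁻ˡ A k<C′) (++⁻ˡ A μ≢A++R++weave))
      (All->-suc (All.tail (++⁻ʳ A k<C′)) (++⁻ˡ R (++⁻ʳ A μ≢A++R++weave))) ,
  All->-suc (++⁻ʳ (A ++ _ ∷ R) k<C′++zs) (All-weave⁻ zs (++⁻ʳ R (++⁻ʳ A μ≢A++R++weave)))
  where
  k<C′ : All (length zs <_) (A ++ suc (length zs) ∷ R)
  k<C′ = ++⁻ˡ (A ++ _ ∷ R) k<C′++zs

-- h sinks to the bottom of the stack; the label k + 1, smaller than everything else in C, then pops all
-- entries above h and stays on h until the weave arrives, so it leaves as the largest label.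
absorbNext : ∀ {n} h A R zs → WovenPerm n (h ∷ A ++ suc (length zs) ∷ R) zs →
  Σ (List ℕ) λ X → s′ ((h ∷ A ++ suc (length zs) ∷ R) ++ weave zs) ≡ X ++ weave (zs ∷ʳ h)
    × WovenPerm n X (zs ∷ʳ h)
absorbNext h A R zs wp@(k<h ∷ k<C′++zs , _) with nextLabel-least h A R zs wp
... | μ<h , μ<A++R , μ<zs
  with run′-prefix-weave (A ++ suc (length zs) ∷ R) h zs (++⁻ˡ (A ++ _ ∷ R) k<C′++zs) k<h (++⁻ʳ (A ++ _ ∷ R) k<C′++zs)
     | run′-new-floor A (suc (length zs)) R h μ<h (++⁻ˡ A μ<A++R) (++⁻ʳ A μ<A++R)
... | Q , through-weave , through-prefix | X , floor
  with refl ← proj₁ (∷ʳ-injective Q (X ∷ʳ suc (length zs)) (trans (sym through-prefix) (trans floor (sym (++-assoc X _ _)))))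
  = X , e , WovenPerm-s′ (h ∷ A ++ _ ∷ R) zs X (zs ∷ʳ h) wp e bound
  where
  e : s′ ((h ∷ A ++ suc (length zs) ∷ R) ++ weave zs) ≡ X ++ weave (zs ∷ʳ h)
  e = begin
    s′ ((h ∷ A ++ suc (length zs) ∷ R) ++ weave zs)   ≡⟨ through-weave ⟩
    (X ∷ʳ suc (length zs)) ++ weave′ zs ∷ʳ h          ≡⟨ ++-assoc X _ _ ⟩
    X ++ suc (length zs) ∷ weave′ zs ∷ʳ h             ≡⟨ cong (X ++_) (weave-∷ʳ zs h) ⟨
    X ++ weave (zs ∷ʳ h)                              ∎
    where open ≡-Reasoning
  X↭A++R : X ++ [] ↭ A ++ R
  X↭A++R = drop-mid X A (run′-over-bottom-↭ (A ++ _ ∷ R) h (X ∷ʳ _) through-prefix)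
  bound : All (length (zs ∷ʳ h) <_) (X ++ zs ∷ʳ h)
  bound rewrite length-∷ʳ zs h = ++⁺ (++⁻ˡ X (All-resp-↭ (↭-sym X↭A++R) μ<A++R)) (∷ʳ⁺ μ<zs μ<h)

Reaches : ℕ → List ℕ → (List ℕ → List ℕ → Set) → Set
Reaches n w P = Σ ℕ λ t → Σ (List ℕ) λ C → Σ (List ℕ) λ zs →
  iter s′ t w ≡ C ++ weave zs × WovenPerm n C zs × P C zs

Reaches-s′ : ∀ {n w w₁ P} → s′ w ≡ w₁ → Reaches n w₁ P → Reaches n w P
Reaches-s′ {w = w} refl (t , C , zs , e , wp , p) = suc t , C , zs , trans (sym (iter-sucˡ s′ t w)) e , wp , p

Reaches-trans : ∀ {n w P Q} → Reaches n w P →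
  (∀ C zs → WovenPerm n C zs → P C zs → Reaches n (C ++ weave zs) Q) → Reaches n w Q
Reaches-trans {w = w} (t , C , zs , e , wp , p) next with next C zs wp p
... | t′ , C′ , zs′ , e′ , wp′ , q =
  t′ + t , C′ , zs′ , trans (iter-+ s′ t t′ w) (trans (cong (iter s′ t′) e) e′) , wp′ , q

Labels : ℕ → List ℕ → List ℕ → Set
Labels k _ zs = length zs ≡ k

Prefix : ℕ → List ℕ → List ℕ → Set
Prefix e C _ = length C ≡ e

absorbNext-reaches : ∀ {n} k h A R zs → length zs ≡ k → WovenPerm n (h ∷ A ++ suc k ∷ R) zs →
  Reaches n ((h ∷ A ++ suc k ∷ R) ++ weave zs) (Labels (suc k))
absorbNext-reaches _ h A R zs refl wp with absorbNext h A R zs wp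
... | X , e , wp′ = 1 , X , zs ∷ʳ h , e , wp′ , length-∷ʳ zs h

absorbLast-reaches : ∀ {n} k Q zs → length zs ≡ k → 1 ≤ length Q → WovenPerm n (Q ∷ʳ suc k) zs →
  Reaches n ((Q ∷ʳ suc k) ++ weave zs) (Labels (suc k))
absorbLast-reaches k (q ∷ Q) zs len _ wp = absorbNext-reaches k q Q [] zs len wp

nextInWeave-reaches : ∀ {n} k B R′ C → length (B ++ suc k ∷ R′) ≡ k → 2 ≤ length C →
  WovenPerm n C (B ++ suc k ∷ R′) → Reaches n (C ++ weave (B ++ suc k ∷ R′)) (Labels (suc k))
nextInWeave-reaches k [] R′ (h ∷ C′) len (s≤s 1≤C′) wp with step-∷ h C′ (suc k) R′ wp
... | Q , Q↭C′ , e , wp′ =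
  Reaches-s′ e (absorbLast-reaches k Q (R′ ∷ʳ h) (trans (length-∷ʳ R′ h) len) (1≤length-↭ Q↭C′ 1≤C′) wp′)
nextInWeave-reaches k (b ∷ B) R′ (h ∷ C′) len (s≤s 1≤C′) wp with step-∷ h C′ b (B ++ suc k ∷ R′) wp
... | Q , Q↭C′ , e , wp′ rewrite ++-assoc B (suc k ∷ R′) (h ∷ []) =
  Reaches-s′ e (nextInWeave-reaches k B (R′ ∷ʳ h) (Q ∷ʳ b) len′ 2≤Q∷ʳb wp′)
  where
  len′ : length (B ++ suc k ∷ R′ ∷ʳ h) ≡ k
  len′ = trans (cong length (sym (++-assoc B (suc k ∷ R′) (h ∷ [])))) (trans (length-∷ʳ (B ++ suc k ∷ R′) h) len)
  2≤Q∷ʳb : 2 ≤ length (Q ∷ʳ b)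
  2≤Q∷ʳb rewrite length-∷ʳ Q b = s≤s (1≤length-↭ Q↭C′ 1≤C′)

labels-grow : ∀ {n} C zs → 2 ≤ length C → WovenPerm n C zs → Reaches n (C ++ weave zs) (Labels (suc (length zs)))
labels-grow {n} C zs 2≤C wp with ∈-++⁻ C (nextLabel-∈ C zs wp k<n)
  where
  k<n : suc (length zs) ≤ n
  k<n = subst (suc (length zs) ≤_) (length-WovenPerm C zs wp)
          (≤-trans (s≤s (m≤m+n _ (length zs))) (+-monoˡ-≤ (length zs + length zs) (≤-trans (s≤s z≤n) 2≤C)))
labels-grow (h ∷ C′) [] (s≤s 1≤C′) wp | inj₁ (here refl) with step-[] h C′ wp
... | Q , Q↭C′ , e , wp′ = Reaches-s′ e (absorbLast-reaches 0 Q [] refl (1≤length-↭ Q↭C′ 1≤C′) wp′)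
labels-grow (h ∷ C′) (z ∷ zs) (s≤s 1≤C′) wp | inj₁ (here refl) with step-∷ h C′ z zs wp
... | Q , Q↭C′ , e , wp′ =
  Reaches-s′ e (nextInWeave-reaches (suc (length zs)) zs [] (Q ∷ʳ z) (length-∷ʳ zs h) 2≤Q∷ʳz wp′)
  where
  2≤Q∷ʳz : 2 ≤ length (Q ∷ʳ z)
  2≤Q∷ʳz rewrite length-∷ʳ Q z = s≤s (1≤length-↭ Q↭C′ 1≤C′)
labels-grow (h ∷ C′) zs 2≤C wp | inj₁ (there ∈C′) with ∈-∃++ ∈C′
... | A , R , refl = absorbNext-reaches (length zs) h A R zs refl wp
labels-grow C zs 2≤C wp | inj₂ ∈zs with ∈-∃++ ∈zs
... | B , R′ , zs≡ = subst (λ zs′ → Reaches _ (C ++ weave zs′) _) (sym zs≡)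
  (nextInWeave-reaches (length zs) B R′ C (sym (cong length zs≡)) 2≤C (subst (WovenPerm _ C) zs≡ wp))

reachPrefix : ∀ {n} e j C zs → length C ≡ e + (j + j) → WovenPerm n C zs → Reaches n (C ++ weave zs) (Prefix e)
reachPrefix e zero C zs len wp = 0 , C , zs , refl , wp , trans len (+-identityʳ e)
reachPrefix {n} e (suc j) C zs len wp = Reaches-trans (labels-grow C zs 2≤C wp) next
  where
  2≤C : 2 ≤ length C
  2≤C rewrite len | +-suc j j = ≤-trans (s≤s (s≤s z≤n)) (m≤n+m (suc (suc (j + j))) e)
  next : ∀ C₂ zs₂ → WovenPerm n C₂ zs₂ → Labels (suc (length zs)) C₂ zs₂ → Reaches n (C₂ ++ weave zs₂) (Prefix e)
  next C₂ zs₂ wp₂ len₂ = reachPrefix e j C₂ zs₂ len₂′ wp₂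
    where
    shuffle : ∀ e j k → e + (suc j + suc j) + (k + k) ≡ e + (j + j) + (suc k + suc k)
    shuffle = solve-∀
    len₂′ : length C₂ ≡ e + (j + j)
    len₂′ = +-cancelʳ-≡ (length zs₂ + length zs₂) _ _ (begin
      length C₂ + (length zs₂ + length zs₂)              ≡⟨ length-WovenPerm C₂ zs₂ wp₂ ⟩
      n                                                  ≡⟨ length-WovenPerm C zs wp ⟨
      length C + (length zs + length zs)                 ≡⟨ cong (_+ (length zs + length zs)) len ⟩
      e + (suc j + suc j) + (length zs + length zs)      ≡⟨ shuffle e j (length zs) ⟩
      e + (j + j) + (suc (length zs) + suc (length zs))  ≡⟨ cong (λ l → e + (j + j) + (l + l)) len₂ ⟨
      e + (j + j) + (length zs₂ + length zs₂)            ∎)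
      where open ≡-Reasoning

rot : List ℕ → List ℕ
rot [] = []
rot (x ∷ xs) = xs ∷ʳ x

rot-↭ : ∀ L → rot L ↭ L
rot-↭ [] = ↭-refl
rot-↭ (x ∷ xs) = ↭-sym (∷↭∷ʳ x xs)

iter-rot-↭ : ∀ t L → iter rot t L ↭ L
iter-rot-↭ zero L = ↭-refl
iter-rot-↭ (suc t) L = ↭-trans (rot-↭ (iter rot t L)) (iter-rot-↭ t L)

length-iter-rot : ∀ t L → length (iter rot t L) ≡ length L
length-iter-rot t L = ↭-length (iter-rot-↭ t L)

iter-rot-++ : ∀ X Z → iter rot (length X) (X ++ Z) ≡ Z ++ X
iter-rot-++ [] Z = sym (++-identityʳ Z)
iter-rot-++ (x ∷ X) Z = begin
  iter rot (suc (length X)) (x ∷ X ++ Z)  ≡⟨ iter-sucˡ rot (length X) (x ∷ X ++ Z) ⟨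
  iter rot (length X) ((X ++ Z) ∷ʳ x)     ≡⟨ cong (iter rot (length X)) (++-assoc X Z (x ∷ [])) ⟩
  iter rot (length X) (X ++ Z ∷ʳ x)       ≡⟨ iter-rot-++ X (Z ∷ʳ x) ⟩
  (Z ∷ʳ x) ++ X                           ≡⟨ ++-assoc Z (x ∷ []) X ⟩
  Z ++ x ∷ X                              ∎
  where open ≡-Reasoning

iter-rot-length : ∀ L → iter rot (length L) L ≡ L
iter-rot-length L = trans (cong (iter rot (length L)) (sym (++-identityʳ L))) (iter-rot-++ L [])

iter-rot-% : ∀ k ℓ L → length L ≡ suc ℓ → iter rot k L ≡ iter rot (k % suc ℓ) L
iter-rot-% k ℓ L len = begin
  iter rot k L
    ≡⟨ cong (λ j → iter rot j L) (m≡m%n+[m/n]*n k (suc ℓ)) ⟩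
  iter rot (k % suc ℓ + k / suc ℓ * suc ℓ) L
    ≡⟨ iter-+ rot (k / suc ℓ * suc ℓ) (k % suc ℓ) L ⟩
  iter rot (k % suc ℓ) (iter rot (k / suc ℓ * suc ℓ) L)
    ≡⟨ cong (iter rot (k % suc ℓ)) (iter-multiple rot (suc ℓ) L full (k / suc ℓ)) ⟩
  iter rot (k % suc ℓ) L ∎
  where
  open ≡-Reasoning
  full : iter rot (suc ℓ) L ≡ L
  full = subst (λ j → iter rot j L ≡ L) len (iter-rot-length L)

rotation-fixing-last : ∀ (X Z B : List ℕ) x → x ∉ X → (Z ∷ʳ x) ++ X ≡ B ∷ʳ x → X ++ Z ≡ B
rotation-fixing-last X Z B x x∉X e with initLast X
... | [] = proj₁ (∷ʳ-injective Z B (trans (sym (++-identityʳ (Z ∷ʳ x))) e))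
... | X′ ∷ʳ′ y = ⊥-elim (x∉X (∈-++⁺ʳ X′ (here (sym y≡x))))
  where
  y≡x : y ≡ x
  y≡x = proj₂ (∷ʳ-injective ((Z ∷ʳ x) ++ X′) B (trans (++-assoc (Z ∷ʳ x) X′ (y ∷ [])) e))

iter-rot-fixing-last : ∀ k (A B : List ℕ) x → x ∉ A → iter rot k (A ∷ʳ x) ≡ B ∷ʳ x → A ≡ B
iter-rot-fixing-last k A B x x∉A e =
  trans (sym X++Z≡A) (rotation-fixing-last X Z B x (x∉A ∘ subst (x ∈_) X++Z≡A ∘ ∈-++⁺ˡ) e′)
  where
  k′ : ℕ
  k′ = k % suc (length A)
  X Z : List ℕ
  X = take k′ A
  Z = drop k′ A
  X++Z≡A : X ++ Z ≡ A
  X++Z≡A = take++drop≡id k′ A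
  length-X : length X ≡ k′
  length-X = trans (length-take k′ A) (m≤n⇒m⊓n≡m (s≤s⁻¹ (m%n<n k (suc (length A)))))
  e′ : (Z ∷ʳ x) ++ X ≡ B ∷ʳ x
  e′ = begin
    (Z ∷ʳ x) ++ X
      ≡⟨ iter-rot-++ X (Z ∷ʳ x) ⟨
    iter rot (length X) (X ++ Z ∷ʳ x)
      ≡⟨ cong₂ (iter rot) length-X (trans (sym (++-assoc X Z (x ∷ []))) (cong (_∷ʳ x) X++Z≡A)) ⟩
    iter rot k′ (A ∷ʳ x)
      ≡⟨ iter-rot-% k (length A) (A ∷ʳ x) (length-∷ʳ A x) ⟨
    iter rot k (A ∷ʳ x)
      ≡⟨ e ⟩
    B ∷ʳ x ∎
    where open ≡-Reasoning

weaveAfter : ℕ → List ℕ → List ℕ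
weaveAfter e L = take e L ++ weave (drop e L)

WovenAfter : ℕ → ℕ → List ℕ → Set
WovenAfter n e L = WovenPerm n (take e L) (drop e L)

weaveAfter-length-++ : ∀ C zs → weaveAfter (length C) (C ++ zs) ≡ C ++ weave zs
weaveAfter-length-++ C zs = cong₂ (λ C′ zs′ → C′ ++ weave zs′) (take-length-++ C zs) (drop-length-++ C zs)

-- With at most two entries in front of the weave, sinkHead permutes nothing and s just rotates L.
s′-weaveAfter : ∀ {n} e L → e ≡ 1 ⊎ e ≡ 2 → e ≤ length L → WovenAfter n e L →
  s′ (weaveAfter e L) ≡ weaveAfter e (rot L) × WovenAfter n e (rot L)
s′-weaveAfter 1 (h ∷ []) (inj₁ refl) _ wa with step-[] h [] wa
... | Q , Q↭[] , e , wa′ with refl ← ↭-empty-inv Q↭[] = e , wa′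
s′-weaveAfter 1 (h ∷ z ∷ zs) (inj₁ refl) _ wa with step-∷ h [] z zs wa
... | Q , Q↭[] , e , wa′ with refl ← ↭-empty-inv Q↭[] = e , wa′
s′-weaveAfter 2 (h ∷ c ∷ []) (inj₂ refl) _ wa with step-[] h (c ∷ []) wa
... | Q , Q↭[c] , e , wa′ with refl ← ↭-singleton-inv Q↭[c] = e , wa′
s′-weaveAfter 2 (h ∷ c ∷ z ∷ zs) (inj₂ refl) _ wa with step-∷ h (c ∷ []) z zs wa
... | Q , Q↭[c] , e , wa′ with refl ← ↭-singleton-inv Q↭[c] = e , wa′
s′-weaveAfter 2 (h ∷ []) (inj₂ refl) (s≤s ()) wa

iter-s′-weaveAfter : ∀ {n} e L t → e ≡ 1 ⊎ e ≡ 2 → e ≤ length L → WovenAfter n e L →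
  iter s′ t (weaveAfter e L) ≡ weaveAfter e (iter rot t L) × WovenAfter n e (iter rot t L)
iter-s′-weaveAfter e L zero e12 e≤ wa = refl , wa
iter-s′-weaveAfter e L (suc t) e12 e≤ wa with iter-s′-weaveAfter e L t e12 e≤ wa
... | eq , wa′ with s′-weaveAfter e (iter rot t L) e12 (subst (e ≤_) (sym (length-iter-rot t L)) e≤) wa′
... | eq′ , wa″ = trans (cong s′ eq) eq′ , wa″

weaveAfter-injective : ∀ e L L′ → e ≤ length L → e ≤ length L′ → weaveAfter e L ≡ weaveAfter e L′ → L ≡ L′
weaveAfter-injective e L L′ e≤L e≤L′ eq
  with ++-cancel-length (take e L) (take e L′) (trans (length-take-≤ L e≤L) (sym (length-take-≤ L′ e≤L′))) eq
  where
  length-take-≤ : ∀ L → e ≤ length L → length (take e L) ≡ e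
  length-take-≤ L e≤ = trans (length-take e L) (m≤n⇒m⊓n≡m e≤)
... | take≡ , weave≡ = begin
  L                       ≡⟨ take++drop≡id e L ⟨
  take e L ++ drop e L    ≡⟨ cong₂ _++_ take≡ (weave-injective _ _ weave≡) ⟩
  take e L′ ++ drop e L′  ≡⟨ take++drop≡id e L′ ⟩
  L′                      ∎
  where open ≡-Reasoning

iter-s′-↭ : ∀ {n} t w → w ↭ upTo₁ n → iter s′ t w ↭ upTo₁ n
iter-s′-↭ zero w w↭ = w↭
iter-s′-↭ (suc t) w w↭ = ↭-trans (s′-↭ (iter s′ t w)) (iter-s′-↭ t w w↭)

iter-s≡iter-s′ : ∀ {n} t w → w ↭ upTo₁ n → iter (s 𝒯) t w ≡ iter s′ t w
iter-s≡iter-s′ zero w w↭ = refl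
iter-s≡iter-s′ {n} (suc t) w w↭ rewrite iter-s≡iter-s′ t w w↭ =
  s≡s′ (iter s′ t w) (Unique-resp-↭ (↭-sym (iter-s′-↭ t w w↭)) (Unique-upTo₁ n))

labels : ℕ → List ℕ
labels k = applyDownFrom suc k

weave-↭ : ∀ zs → weave zs ↭ labels (length zs) ++ zs
weave-↭ [] = ↭-refl
weave-↭ (z ∷ zs) = ↭-prep _ (↭-trans (↭-prep z (weave-↭ zs)) (↭-sym (shift z (labels (length zs)) zs)))

upper : ℕ → (r : ℕ) → Vec ℕ r
upper k zero = []
upper k (suc r) = upper k r ∷ʳᵥ suc (k + r)

All-upper : ∀ k r → All (k <_) (toList (upper k r))
All-upper k zero = []
All-upper k (suc r) rewrite toList-∷ʳ (suc (k + r)) (upper k r) = ∷ʳ⁺ (All-upper k r) (s≤s (m≤m+n k r))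

upTo₁-split : ∀ k r → upTo₁ (k + r) ↭ labels k ++ toList (upper k r)
upTo₁-split k zero = begin
  upTo₁ (k + 0)      ≡⟨ cong upTo₁ (+-identityʳ k) ⟩
  upTo₁ k            ↭⟨ ↭-reverse (upTo₁ k) ⟨
  reverse (upTo₁ k)  ≡⟨ reverse-applyUpTo suc k ⟩
  labels k           ≡⟨ ++-identityʳ (labels k) ⟨
  labels k ++ []     ∎
  where open PermutationReasoning
upTo₁-split k (suc r) = begin
  upTo₁ (k + suc r)                                ≡⟨ cong upTo₁ (+-suc k r) ⟩
  upTo₁ (suc (k + r))                              ≡⟨ applyUpTo-∷ʳ suc (k + r) ⟨
  upTo₁ (k + r) ∷ʳ suc (k + r)                     ↭⟨ ++⁺ʳ _ (upTo₁-split k r) ⟩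
  (labels k ++ toList (upper k r)) ∷ʳ suc (k + r)  ≡⟨ ++-assoc (labels k) _ _ ⟩
  labels k ++ toList (upper k r) ∷ʳ suc (k + r)    ≡⟨ cong (labels k ++_) (toList-∷ʳ (suc (k + r)) (upper k r)) ⟨
  labels k ++ toList (upper k (suc r))             ∎
  where open PermutationReasoning

woven-↭ : ∀ C zs → C ++ weave zs ↭ labels (length zs) ++ C ++ zs
woven-↭ C zs = begin
  C ++ weave zs                  ↭⟨ ++⁺ˡ C (weave-↭ zs) ⟩
  C ++ labels (length zs) ++ zs  ↭⟨ shifts C (labels (length zs)) ⟩
  labels (length zs) ++ C ++ zs  ∎
  where open PermutationReasoning

WovenPerm⇒↭ : ∀ k r C zs → length zs ≡ k → WovenPerm (k + r) C zs → C ++ zs ↭ toList (upper k r)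
WovenPerm⇒↭ k r C zs refl (_ , w↭) =
  ↭-cancelˡ (labels k) (↭-trans (↭-sym (woven-↭ C zs)) (↭-trans w↭ (upTo₁-split k r)))

↭⇒WovenPerm : ∀ k r C zs → length zs ≡ k → C ++ zs ↭ toList (upper k r) → WovenPerm (k + r) C zs
↭⇒WovenPerm k r C zs refl L↭ =
  All-resp-↭ (↭-sym L↭) (All-upper k r) ,
  ↭-trans (woven-↭ C zs) (↭-trans (++⁺ˡ (labels k) L↭) (↭-sym (upTo₁-split k r)))

-- Enumerating the permutations of a vector

removeAt-↭ : ∀ {k} (v : Vec ℕ (suc k)) j → toList v ↭ lookup v j ∷ toList (removeAt v j)
removeAt-↭ (x ∷ xs) zero = ↭-refl
removeAt-↭ (x ∷ xs@(_ ∷ _)) (suc j) = ↭-trans (↭-prep x (removeAt-↭ xs j)) (↭-swap x (lookup xs j) ↭-refl)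

-- i is read in the factorial number system: remQuot splits it into the position of the first entry
-- and the index of the arrangement of the remaining ones.
permAt : ∀ {k} → Vec ℕ k → Fin (k !) → List ℕ
permAt {zero} [] i = []
permAt {suc k} v i = lookup v j ∷ permAt (removeAt v j) i′
  where
  j : Fin (suc k)
  j = proj₁ (remQuot {suc k} (k !) i)
  i′ : Fin (k !)
  i′ = proj₂ (remQuot {suc k} (k !) i)

permAt-↭ : ∀ {k} (v : Vec ℕ k) i → permAt v i ↭ toList v
permAt-↭ {zero} [] i = ↭-refl
permAt-↭ {suc k} v i =
  ↭-trans (↭-prep _ (permAt-↭ (removeAt v j) (proj₂ (remQuot {suc k} (k !) i)))) (↭-sym (removeAt-↭ v j))
  where
  j : Fin (suc k)
  j = proj₁ (remQuot {suc k} (k !) i)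

permAt-surjective : ∀ {k} (v : Vec ℕ k) w → w ↭ toList v → Σ (Fin (k !)) λ i → permAt v i ≡ w
permAt-surjective {zero} [] w w↭ = zero , sym (↭-empty-inv w↭)
permAt-surjective {suc k} (x ∷ xs) [] w↭ with () ← ↭-empty-inv (↭-sym w↭)
permAt-surjective {suc k} v (a ∷ w) w↭ with ∈-toList⁻ (∈-resp-↭ w↭ (here refl))
... | a∈v with permAt-surjective (removeAt v (index a∈v)) w (drop-∷ (↭-trans w↭ v↭))
  where
  v↭ : toList v ↭ a ∷ toList (removeAt v (index a∈v))
  v↭ = subst (λ b → toList v ↭ b ∷ toList (removeAt v (index a∈v))) (sym (lookup-index a∈v)) (removeAt-↭ v (index a∈v))
... | i′ , permAt≡w = combine (index a∈v) i′ , (begin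
  permAt v (combine (index a∈v) i′)
    ≡⟨ cong (λ p → lookup v (proj₁ p) ∷ permAt (removeAt v (proj₁ p)) (proj₂ p))
            (remQuot-combine {suc k} {k !} (index a∈v) i′) ⟩
  lookup v (index a∈v) ∷ permAt (removeAt v (index a∈v)) i′
    ≡⟨ cong₂ _∷_ (sym (lookup-index a∈v)) permAt≡w ⟩
  a ∷ w ∎)
  where open ≡-Reasoning

lookup-injective : ∀ {k} (v : Vec ℕ k) → Unique (toList v) → ∀ j j′ → lookup v j ≡ lookup v j′ → j ≡ j′
lookup-injective (x ∷ v) u zero zero e = refl
lookup-injective (x ∷ v) (x≢ ∷ u) zero (suc j′) e = ⊥-elim (All.lookup x≢ (∈-toList⁺ (∈-lookup j′ v)) e)
lookup-injective (x ∷ v) (x≢ ∷ u) (suc j) zero e = ⊥-elim (All.lookup x≢ (∈-toList⁺ (∈-lookup j v)) (sym e))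
lookup-injective (x ∷ v) (_ ∷ u) (suc j) (suc j′) e = cong suc (lookup-injective v u j j′ e)

permAt-injective : ∀ {k} (v : Vec ℕ k) → Unique (toList v) → ∀ i i′ → permAt v i ≡ permAt v i′ → i ≡ i′
permAt-injective {zero} [] u zero zero e = refl
permAt-injective {suc k} v u i i′ e = begin
  i                              ≡⟨ combine-remQuot {suc k} (k !) i ⟨
  combine (proj₁ q) (proj₂ q)    ≡⟨ cong₂ combine j≡ i≡ ⟩
  combine (proj₁ q′) (proj₂ q′)  ≡⟨ combine-remQuot {suc k} (k !) i′ ⟩
  i′                             ∎
  where
  open ≡-Reasoning
  q q′ : Fin (suc k) × Fin (k !)
  q = remQuot {suc k} (k !) i
  q′ = remQuot {suc k} (k !) i′
  j≡ : proj₁ q ≡ proj₁ q′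
  j≡ = lookup-injective v u _ _ (proj₁ (∷-injective e))
  u-rest : Unique (toList (removeAt v (proj₁ q)))
  u-rest with Unique-resp-↭ (removeAt-↭ v (proj₁ q)) u
  ... | _ ∷ u′ = u′
  i≡ : proj₂ q ≡ proj₂ q′
  i≡ = permAt-injective (removeAt v (proj₁ q)) u-rest _ _
         (trans (proj₂ (∷-injective e)) (cong (λ j → permAt (removeAt v j) (proj₂ q′)) (sym j≡)))

-- Counting the periodic orbits

module Orbits (e d m : ℕ) (e12 : e ≡ 1 ⊎ e ≡ 2) (m+1≡e+d : suc m ≡ e + d) where

  N : ℕ
  N = d + suc m

  N≡e+2d : N ≡ e + (d + d)
  N≡e+2d = trans (cong (d +_) m+1≡e+d) (shuffle d e)
    where
    shuffle : ∀ d e → d + (e + d) ≡ e + (d + d)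
    shuffle = solve-∀

  top : ℕ
  top = suc (d + m)

  V : Vec ℕ m
  V = upper d m

  range : List ℕ
  range = toList V ∷ʳ top

  upper≡range : toList (upper d (suc m)) ≡ range
  upper≡range = toList-∷ʳ top V

  Unique-range : Unique range
  Unique-range = subst Unique upper≡range
    (Unique-++⁻ʳ (labels d) (Unique-resp-↭ (upTo₁-split d (suc m)) (Unique-upTo₁ N)))

  length-range : length range ≡ e + d
  length-range = trans (length-∷ʳ (toList V) top) (trans (cong suc (length-toList V)) m+1≡e+d)

  shape : ∀ L → L ↭ range → e ≤ length L × length (drop e L) ≡ d
  shape L L↭ = subst (e ≤_) (sym len) (m≤m+n e d) , trans (length-drop e L) (trans (cong (_∸ e) len) (m+n∸m≡n e d))
    where
    len : length L ≡ e + d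
    len = trans (↭-length L↭) length-range

  WovenAfter-range : ∀ L → L ↭ range → WovenAfter N e L
  WovenAfter-range L L↭ = ↭⇒WovenPerm d (suc m) (take e L) (drop e L) (proj₂ (shape L L↭))
    (subst₂ _↭_ (sym (take++drop≡id e L)) (sym upper≡range) L↭)

  labels-count : ∀ C zs → length C ≡ e → WovenPerm N C zs → length zs ≡ d
  labels-count C zs lenC wp = double-injective (+-cancelˡ-≡ e _ _
    (trans (cong (_+ (length zs + length zs)) (sym lenC)) (trans (length-WovenPerm C zs wp) N≡e+2d)))

  cycle : Fin (m !) → List ℕ
  cycle i = permAt V i ∷ʳ top

  cycle-↭ : ∀ i → cycle i ↭ range
  cycle-↭ i = ++⁺ʳ (top ∷ []) (permAt-↭ V i)

  rep : Fin (m !) → List ℕ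
  rep i = weaveAfter e (cycle i)

  iter-rep : ∀ t i → iter (s 𝒯) t (rep i) ≡ weaveAfter e (iter rot t (cycle i))
  iter-rep t i = trans (iter-s≡iter-s′ t (rep i) (proj₂ (WovenAfter-range _ (cycle-↭ i))))
    (proj₁ (iter-s′-weaveAfter e (cycle i) t e12 (proj₁ (shape _ (cycle-↭ i))) (WovenAfter-range _ (cycle-↭ i))))

  rep-periodic : ∀ i → Periodic (s 𝒯) (rep i)
  rep-periodic i = suc m , s≤s z≤n , trans (iter-rep (suc m) i) (cong (weaveAfter e) full-turn)
    where
    full-turn : iter rot (suc m) (cycle i) ≡ cycle i
    full-turn = subst (λ t → iter rot t (cycle i) ≡ cycle i)
      (trans (↭-length (cycle-↭ i)) (trans (length-∷ʳ (toList V) top) (cong suc (length-toList V))))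
      (iter-rot-length (cycle i))

  rep-distinct : ∀ i j → InOrbit (s 𝒯) (rep i) (rep j) → i ≡ j
  rep-distinct i j (k , eq) = permAt-injective V (Unique-++⁻ˡ (toList V) Unique-range) i j
    (iter-rot-fixing-last k (permAt V i) (permAt V j) top top∉ rotated)
    where
    rotated : iter rot k (cycle i) ≡ cycle j
    rotated = weaveAfter-injective e _ _
      (subst (e ≤_) (sym (length-iter-rot k (cycle i))) (proj₁ (shape _ (cycle-↭ i))))
      (proj₁ (shape _ (cycle-↭ j))) (trans (sym (iter-rep k i)) eq)
    top∉ : top ∉ permAt V i
    top∉ top∈ =
      All.lookup (++⁻ˡ (permAt V i) (Unique-middle (permAt V i) top (Unique-resp-↭ (↭-sym (cycle-↭ i)) Unique-range)))
        top∈ refl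

  periodic-woven : ∀ a → a ↭ upTo₁ N → Periodic (s 𝒯) a → Σ (List ℕ) λ L → a ≡ weaveAfter e L × L ↭ range
  periodic-woven a a↭ (suc p , _ , fix)
    with reachPrefix e d a [] (trans (↭-length a↭) (trans (length-applyUpTo suc N) N≡e+2d))
           (↭⇒WovenPerm 0 N a [] refl (↭-trans (subst (_↭ upTo₁ N) (sym (++-identityʳ a)) a↭) (upTo₁-split 0 N)))
  ... | t , C , zs , reached , wp , lenC = iter rot (t * p) (C ++ zs) , a≡ , ↭-trans (iter-rot-↭ (t * p) (C ++ zs)) C++zs↭
    where
    C++zs↭ : C ++ zs ↭ range
    C++zs↭ = subst (C ++ zs ↭_) upper≡range (WovenPerm⇒↭ d (suc m) C zs (labels-count C zs lenC wp) wp)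
    woven : weaveAfter e (C ++ zs) ≡ C ++ weave zs
    woven = subst (λ e′ → weaveAfter e′ (C ++ zs) ≡ C ++ weave zs) lenC (weaveAfter-length-++ C zs)
    a≡ : a ≡ weaveAfter e (iter rot (t * p) (C ++ zs))
    a≡ = begin
      a
        ≡⟨ periodic-return s′ p a (trans (sym (iter-s≡iter-s′ (suc p) a a↭)) fix) t ⟨
      iter s′ (t * p) (iter s′ t a)
        ≡⟨ cong (iter s′ (t * p)) (trans (cong (iter s′ t) (sym (++-identityʳ a))) reached) ⟩
      iter s′ (t * p) (C ++ weave zs)
        ≡⟨ cong (iter s′ (t * p)) woven ⟨
      iter s′ (t * p) (weaveAfter e (C ++ zs))
        ≡⟨ proj₁ (iter-s′-weaveAfter e (C ++ zs) (t * p) e12 (proj₁ (shape _ C++zs↭)) (WovenAfter-range _ C++zs↭)) ⟩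
      weaveAfter e (iter rot (t * p) (C ++ zs)) ∎
      where open ≡-Reasoning

  rep-covers : ∀ a → Sₙ N a → Periodic (s 𝒯) a → Σ (Fin (m !)) λ i → InOrbit (s 𝒯) (rep i) a
  rep-covers a a↭ per with periodic-woven a a↭ per
  ... | L , a≡ , L↭ with ∈-∃++ (∈-resp-↭ (↭-sym L↭) (∈-++⁺ʳ (toList V) (here refl)))
  ... | X , Y , refl with permAt-surjective V (Y ++ X) Y++X↭
    where
    Y++X↭ : Y ++ X ↭ toList V
    Y++X↭ = ↭-trans (++-comm Y X) (subst (X ++ Y ↭_) (++-identityʳ (toList V)) (drop-mid X (toList V) L↭))
  ... | i , permAt≡ = i , length Y , (begin
    iter (s 𝒯) (length Y) (rep i)
      ≡⟨ iter-rep (length Y) i ⟩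
    weaveAfter e (iter rot (length Y) (permAt V i ∷ʳ top))
      ≡⟨ cong (λ σ → weaveAfter e (iter rot (length Y) (σ ∷ʳ top))) permAt≡ ⟩
    weaveAfter e (iter rot (length Y) ((Y ++ X) ∷ʳ top))
      ≡⟨ cong (weaveAfter e ∘ iter rot (length Y)) (++-assoc Y X (top ∷ [])) ⟩
    weaveAfter e (iter rot (length Y) (Y ++ X ∷ʳ top))
      ≡⟨ cong (weaveAfter e) (iter-rot-++ Y (X ∷ʳ top)) ⟩
    weaveAfter e ((X ∷ʳ top) ++ Y)
      ≡⟨ cong (weaveAfter e) (++-assoc X (top ∷ []) Y) ⟩
    weaveAfter e (X ++ top ∷ Y)
      ≡⟨ a≡ ⟨
    a ∎)
    where open ≡-Reasoning

  orbitCount : HasPeriodicOrbitCount (Sₙ N) (s 𝒯) (m !)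
  orbitCount = rep , (λ i → proj₂ (WovenAfter-range _ (cycle-↭ i)) , rep-periodic i) , rep-distinct , rep-covers

corollary4p2 : (n : ℕ) → 1 ≤ n →
    HasPeriodicOrbitCount (Sₙ n) (s (p123 ∷ p132 ∷ [])) ((n / 2) !)
corollary4p2 n 1≤n with n % 2 | n / 2 | m%n<n n 2 | m≡m%n+[m/n]*n n 2
... | 0 | zero | _ | refl with () ← 1≤n
... | 0 | suc d | _ | refl =
  subst (λ N → HasPeriodicOrbitCount (Sₙ N) (s 𝒯) (suc d !)) (even d) (Orbits.orbitCount 2 d (suc d) (inj₂ refl) refl)
  where
  even : ∀ d → d + suc (suc d) ≡ 0 + suc d * 2
  even = solve-∀
... | 1 | d | _ | refl =
  subst (λ N → HasPeriodicOrbitCount (Sₙ N) (s 𝒯) (d !)) (odd d) (Orbits.orbitCount 1 d d (inj₁ refl) refl)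
  where
  odd : ∀ d → d + suc d ≡ 1 + d * 2
  odd = solve-∀
... | suc (suc _) | _ | s≤s (s≤s ()) | _
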